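{- Let $r\ge 2$ be an integer. If $G$ is an $(r+1)$-clique-free graph of order $n$, then $$\gamma^{NN}_{s}(G)\ge-\frac{2r}{r-1}+\frac{2}{r-1}\sqrt{r^{2}+r(r-1)n}-n.$$ Furthermore, equality holds if and only if $G=H\circ \overline{K_{(r-1)p+1}}$ for some positive integer $p$, where $H$ is a complete $r$-partite graph with exactly $p$ vertices in each partite set.
   Context: All graphs are finite and simple. A graph is $(r+1)$-clique-free if it contains no complete subgraph $K_{r+1}$. For a vertex $v$, $N[v]=N(v)\cup\{v\}$; for $f:V(G)\to\mathbb{R}$ and $S\subseteq V(G)$, $f(S)=\sum_{v\in S}f(v)$. A nonnegative signed dominating function (NNSDF) of $G$ is a function $f:V(G)\to\{ -1,1\}$ with $f(N[v])\ge 0$ for every $v\in V(G)$; $\gamma^{NN}_s(G)$ is the minimum of $f(V(G))$ over all NNSDFs $f$ of $G$. The corona $G_1\circ G_2$ is the graph formed from one copy of $G_1$ and $|V(G_1)|$ copies of $G_2$, where the $i$-th vertex of $G_1$ is joined to every vertex of the $i$-th copy of $G_2$. $\overline{K_m}$ denotes the edgeless graph on $m$ vertices. -}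

module Defs where

open import Data.Bool using (Bool; true; false; if_then_else_)
open import Data.Nat using (ℕ; zero; suc)
open import Data.Fin using (Fin; zero; suc; _≟_)
open import Data.Integer using (ℤ; +_; -_; _+_; _*_; _-_; _≤_; 0ℤ; 1ℤ)
open import Data.Maybe using (Maybe; just; nothing)
open import Data.Product using (Σ; _×_; _,_; ∃; proj₁; proj₂)
open import Data.Sum using (_⊎_)
open import Data.Unit using (⊤)
open import Data.Empty using (⊥)
open import Relation.Binary.PropositionalEquality using (_≡_; _≢_)
open import Relation.Nullary using (¬_; yes; no)
open import Function.Bundles using (_↔_; Inverse; _⇔_)

record Graph (n : ℕ) : Set where
  field
    adj    : Fin n → Fin n → Bool
    sym    : ∀ u v → adj u v ≡ adj v u
    irrefl : ∀ v → adj v v ≡ false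
open Graph public

CliqueFree : ∀ {n} → ℕ → Graph n → Set
CliqueFree {n} r G =
  ¬ (Σ (Fin (suc r) → Fin n) λ c →
       ∀ i j → i ≢ j → adj G (c i) (c j) ≡ true)

sumFin : ∀ {n} → (Fin n → ℤ) → ℤ
sumFin {zero}  f = 0ℤ
sumFin {suc n} f = f zero + sumFin (λ i → f (suc i))

closedNbhdSum : ∀ {n} → Graph n → (Fin n → ℤ) → Fin n → ℤ
closedNbhdSum G f v = sumFin λ u → inN u
  where
  inN : _ → ℤ
  inN u with u ≟ v
  ... | yes _ = f u
  ... | no  _ = if adj G u v then f u else 0ℤ

IsNNSDF : ∀ {n} → Graph n → (Fin n → ℤ) → Set
IsNNSDF G f =
  (∀ v → (f v ≡ 1ℤ) ⊎ (f v ≡ - 1ℤ)) × (∀ v → 0ℤ ≤ closedNbhdSum G f v)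

IsNNSignedDomNumber : ∀ {n} → Graph n → ℤ → Set
IsNNSignedDomNumber G γ =
  (Σ _ λ f → IsNNSDF G f × sumFin f ≡ γ) ×
  (∀ f → IsNNSDF G f → γ ≤ sumFin f)

-- The corona H ∘ K̄_m, where H is the complete r-partite graph with p
-- vertices in each part.  H-vertices are (part, index) ∈ Fin r × Fin p;
-- a corona vertex is (x , nothing) (the H-vertex x itself) or
-- (x , just j) (the j-th vertex of the copy of K̄_m attached to x).
CoronaV : ℕ → ℕ → ℕ → Set
CoronaV r p m = (Fin r × Fin p) × Maybe (Fin m)

CoronaAdj : ∀ {r p m} → CoronaV r p m → CoronaV r p m → Set
CoronaAdj ((i , _) , nothing) ((j , _) , nothing) = i ≢ j
CoronaAdj (x , nothing) (y , just _) = x ≡ y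
CoronaAdj (x , just _) (y , nothing) = x ≡ y
CoronaAdj (_ , just _) (_ , just _) = ⊥

IsoToCorona : ∀ {n} → Graph n → ℕ → ℕ → ℕ → Set
IsoToCorona {n} G r p m =
  Σ (Fin n ↔ CoronaV r p m) λ φ →
    ∀ u v → (adj G u v ≡ true) ⇔ CoronaAdj (Inverse.to φ u) (Inverse.to φ v)

{-# OPTIONS --safe #-}
module Submission where

-- Let f be an NNSDF of minimum weight, P = f⁻¹(1), M = f⁻¹(-1), k = |P| and m = |M|, so that
-- γ = k - m and n = k + m.  Summing f(N[v]) ≥ 0 over v ∈ M and over v ∈ P and double counting
-- the edges between M and P gives m + 2e(M) ≤ e(M,P) ≤ k + 2e(P), and Turán's theorem gives
-- r·2e(P) ≤ (r-1)k²; hence r m ≤ r k + (r-1)k².  For a = (r-1)(γ + n) + 2r = 2(r-1)k + 2r one has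
-- a² - 4D = 4(r-1)(r k + (r-1)k² - r m), which is the bound.  In the case of equality every step is
-- tight: M is independent, every vertex of M has exactly one neighbour in P, every x ∈ P has one
-- more neighbour in M than in P, and P spans a balanced complete r-partite graph (equality in
-- Turán's theorem); this is the corona H ∘ K̄_{(r-1)p+1}.  Conversely, on that corona the function
-- that is 1 exactly on H is an NNSDF attaining the bound, so the minimum attains it as well.

open import Data.Nat using (ℕ; suc; NonZero)
open import Data.Integer using (ℤ)
open import Defs using (Graph; CliqueFree; IsNNSignedDomNumber)

module Arithmetic where

  open import Data.Nat
  open import Data.Nat.Properties
  open import Data.Nat.Tactic.RingSolver using (solve-∀)
  open import Data.Product using (_×_; _,_; proj₁; proj₂)
  open import Data.Sum using (inj₁; inj₂)
  open import Relation.Binary.PropositionalEquality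

  +-tight : ∀ {a b c d} → a ≤ c → b ≤ d → a + b ≡ c + d → a ≡ c × b ≡ d
  +-tight {a} {b} {c} {d} a≤c b≤d eq = a≡c , +-cancelˡ-≡ a b d (trans eq (cong (_+ d) (sym a≡c)))
    where
    a≡c : a ≡ c
    a≡c = ≤-antisym a≤c (+-cancelʳ-≤ d c a (≤-trans (≤-reflexive (sym eq)) (+-monoʳ-≤ a b≤d)))

  ≤-squeeze : ∀ {a b c} → a ≤ b → b ≤ c → a ≡ c → a ≡ b × b ≡ c
  ≤-squeeze a≤b b≤c refl = ≤-antisym a≤b b≤c , ≤-antisym b≤c a≤b

  am-gm-gap : ∀ x y → 2 * x * y + ∣ x - y ∣ * ∣ x - y ∣ ≡ x * x + y * y
  am-gm-gap x y with ≤-total x y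
  ... | inj₁ x≤y with d , refl ← m≤n⇒∃[o]m+o≡n x≤y rewrite ∣m-m+n∣≡n x d = expanded x d
    where
    expanded : ∀ x d → 2 * x * (x + d) + d * d ≡ x * x + (x + d) * (x + d)
    expanded = solve-∀
  ... | inj₂ y≤x with d , refl ← m≤n⇒∃[o]m+o≡n y≤x rewrite ∣-∣-comm (y + d) y | ∣m-m+n∣≡n y d = expanded y d
    where
    expanded : ∀ y d → 2 * (y + d) * y + d * d ≡ (y + d) * (y + d) + y * y
    expanded = solve-∀

  am-gm : ∀ x y → 2 * x * y ≤ x * x + y * y
  am-gm x y = subst (2 * x * y ≤_) (am-gm-gap x y) (m≤m+n (2 * x * y) _)

  am-gm-tight : ∀ x y → x * x + y * y ≡ 2 * x * y → x ≡ y
  am-gm-tight x y eq = ∣m-n∣≡0⇒m≡n (m*m≡0⇒m≡0 gap≡0)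
    where
    gap≡0 : ∣ x - y ∣ * ∣ x - y ∣ ≡ 0
    gap≡0 = +-cancelˡ-≡ (2 * x * y) _ 0 (trans (am-gm-gap x y) (trans eq (sym (+-identityʳ _))))
    m*m≡0⇒m≡0 : ∀ {m} → m * m ≡ 0 → m ≡ 0
    m*m≡0⇒m≡0 {zero} _ = refl

  -- The arithmetic of the inductive step of Turán's theorem, with t = s + 1, E = e[S,S] = E′ + X + Y,
  -- E′ = e[N,N], X = e[N,R], Y = e[R,S], x = |N| and c = |R|.  Besides the hypotheses it only uses
  -- AM-GM in the form 2·x·(t c) ≤ x² + (t c)², whose equality case gives x = t c.
  module TuránStep (s : ℕ) {E E′ X Y x c : ℕ} (E≡ : E ≡ E′ + X + Y) (X≤Y : X ≤ Y) (Y≤cx : Y ≤ c * x)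
                   (IH : suc s * E′ ≤ s * (x * x)) where
    private
      t : ℕ
      t = suc s

      expand : t * (suc t * E) ≡ suc t * (t * E′) + t * suc t * (X + Y)
      expand rewrite E≡ = expanded s E′ X Y
        where
        expanded : ∀ s E′ X Y → suc s * ((2 + s) * (E′ + X + Y)) ≡
                                (2 + s) * (suc s * E′) + suc s * (2 + s) * (X + Y)
        expanded = solve-∀

      gap : suc t * (s * (x * x)) + t * suc t * (c * x + c * x) + (x * x + (t * c) * (t * c)) ≡
            t * (t * ((x + c) * (x + c))) + 2 * x * (t * c)
      gap = expanded s x c
        where
        expanded : ∀ s x c → (2 + s) * (s * (x * x)) + suc s * (2 + s) * (c * x + c * x) +
                             (x * x + (suc s * c) * (suc s * c)) ≡
                             suc s * (suc s * ((x + c) * (x + c))) + 2 * x * (suc s * c)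
        expanded = solve-∀

      X+Y≤ : X + Y ≤ c * x + c * x
      X+Y≤ = +-mono-≤ (≤-trans X≤Y Y≤cx) Y≤cx

      by-hypotheses : suc t * (t * E′) + t * suc t * (X + Y) ≤
                      suc t * (s * (x * x)) + t * suc t * (c * x + c * x)
      by-hypotheses = +-mono-≤ (*-monoʳ-≤ (suc t) IH) (*-monoʳ-≤ (t * suc t) X+Y≤)

      by-am-gm : suc t * (s * (x * x)) + t * suc t * (c * x + c * x) ≤ t * (t * ((x + c) * (x + c)))
      by-am-gm = +-cancelʳ-≤ _ _ _ (≤-trans (≤-reflexive gap) (+-monoʳ-≤ _ (am-gm x (t * c))))

    bound : suc t * E ≤ t * ((x + c) * (x + c))
    bound = *-cancelˡ-≤ t (≤-trans (≤-reflexive expand) (≤-trans by-hypotheses by-am-gm))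

    module Tight (eq : suc t * E ≡ t * ((x + c) * (x + c))) where
      private
        squeeze : suc t * (t * E′) + t * suc t * (X + Y) ≡ suc t * (s * (x * x)) + t * suc t * (c * x + c * x)
                × suc t * (s * (x * x)) + t * suc t * (c * x + c * x) ≡ t * (t * ((x + c) * (x + c)))
        squeeze = ≤-squeeze by-hypotheses by-am-gm (trans (sym expand) (cong (t *_) eq))

        split : suc t * (t * E′) ≡ suc t * (s * (x * x)) × t * suc t * (X + Y) ≡ t * suc t * (c * x + c * x)
        split = +-tight (*-monoʳ-≤ (suc t) IH) (*-monoʳ-≤ (t * suc t) X+Y≤) (proj₁ squeeze)

        X≡cx×Y≡cx : X ≡ c * x × Y ≡ c * x
        X≡cx×Y≡cx = +-tight (≤-trans X≤Y Y≤cx) Y≤cx (*-cancelˡ-≡ _ _ (t * suc t) (proj₂ split))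

      IH-tight : t * E′ ≡ s * (x * x)
      IH-tight = *-cancelˡ-≡ _ _ (suc t) (proj₁ split)

      Y≡cx : Y ≡ c * x
      Y≡cx = proj₂ X≡cx×Y≡cx

      X≡Y : X ≡ Y
      X≡Y = trans (proj₁ X≡cx×Y≡cx) (sym Y≡cx)

      x≡tc : x ≡ t * c
      x≡tc = am-gm-tight x (t * c)
        (+-cancelˡ-≡ _ _ _ (trans (sym (cong (_+ (x * x + (t * c) * (t * c))) (proj₂ squeeze))) gap))

module Counting where

  open import Data.Bool as Bool using (Bool; true; false; if_then_else_; _∧_; not)
  open import Data.Bool.Properties using (∧-zeroʳ)
  open import Data.Fin using (Fin; zero; suc; toℕ; fromℕ<; _≟_)
  open import Data.Fin.Properties using (toℕ<n; toℕ-injective; toℕ-fromℕ<; injective⇒≤; any?)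
  open import Data.Nat hiding (_≟_)
  open import Data.Nat.DivMod using (_mod_; m<n⇒m%n≡m)
  open import Data.Nat.Properties hiding (_≟_)
  open import Algebra.Properties.CommutativeMonoid.Sum +-0-commutativeMonoid
    using (sum; sum-cong-≗; sum-replicate-zero; ∑-distrib-+; ∑-comm)
  open import Data.Product using (∃; _×_; _,_; proj₁)
  open import Data.Sum using (_⊎_; inj₁; inj₂)
  open import Relation.Binary.PropositionalEquality
  open import Relation.Nullary using (yes; no; does; contradiction)
  open Arithmetic using (+-tight)

  private variable
    n c : ℕ

  sum-mono-≤ : {f g : Fin n → ℕ} → (∀ u → f u ≤ g u) → sum f ≤ sum g
  sum-mono-≤ {zero}  f≤g = z≤n
  sum-mono-≤ {suc n} f≤g = +-mono-≤ (f≤g zero) (sum-mono-≤ (λ u → f≤g (suc u)))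

  sum-tight : {f g : Fin n → ℕ} → (∀ u → f u ≤ g u) → sum f ≡ sum g → ∀ u → f u ≡ g u
  sum-tight {suc n} f≤g eq u with +-tight (f≤g zero) (sum-mono-≤ (λ u → f≤g (suc u))) eq
  sum-tight {suc n} f≤g eq zero    | head , _ = head
  sum-tight {suc n} f≤g eq (suc u) | _ , tail = sum-tight (λ u → f≤g (suc u)) tail u

  sumOver : (Fin n → Bool) → (Fin n → ℕ) → ℕ
  sumOver X f = sum λ u → if X u then f u else 0

  syntax sumOver X (λ u → e) = ∑[ u ∈ X ] e

  count : (Fin n → Bool) → ℕ
  count X = ∑[ u ∈ X ] 1

  𝟙 : Bool → ℕ
  𝟙 b = if b then 1 else 0

  private
    if-mono-≤ : ∀ b {x y} → (b ≡ true → x ≤ y) → (if b then x else 0) ≤ (if b then y else 0)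
    if-mono-≤ true  x≤y = x≤y refl
    if-mono-≤ false _   = z≤n

  sumOver-cong : {X : Fin n → Bool} {f g : Fin n → ℕ} →
                 (∀ u → X u ≡ true → f u ≡ g u) → sumOver X f ≡ sumOver X g
  sumOver-cong {X = X} {f} {g} f≡g = sum-cong-≗ pointwise
    where
    pointwise : ∀ u → (if X u then f u else 0) ≡ (if X u then g u else 0)
    pointwise u with X u in Xu
    ... | true  = f≡g u Xu
    ... | false = refl

  sumOver-mono-≤ : {X : Fin n → Bool} {f g : Fin n → ℕ} →
                   (∀ u → X u ≡ true → f u ≤ g u) → sumOver X f ≤ sumOver X g
  sumOver-mono-≤ {X = X} f≤g = sum-mono-≤ (λ u → if-mono-≤ (X u) (f≤g u))

  sumOver-tight : {X : Fin n → Bool} {f g : Fin n → ℕ} →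
                  (∀ u → X u ≡ true → f u ≤ g u) → sumOver X f ≡ sumOver X g →
                  ∀ u → X u ≡ true → f u ≡ g u
  sumOver-tight {X = X} {f} {g} f≤g eq u Xu =
    subst (λ b → (if b then f u else 0) ≡ (if b then g u else 0)) Xu
          (sum-tight (λ u → if-mono-≤ (X u) (f≤g u)) eq u)

  sumOver-+ : (X : Fin n → Bool) (f g : Fin n → ℕ) →
              ∑[ u ∈ X ] (f u + g u) ≡ sumOver X f + sumOver X g
  sumOver-+ X f g =
    trans (sum-cong-≗ pointwise) (∑-distrib-+ (λ u → if X u then f u else 0) (λ u → if X u then g u else 0))
    where
    pointwise : ∀ u → (if X u then f u + g u else 0) ≡ (if X u then f u else 0) + (if X u then g u else 0)
    pointwise u with X u
    ... | true  = refl
    ... | false = refl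

  sumOver-split : (X B : Fin n → Bool) (f : Fin n → ℕ) →
                  sumOver X f ≡ sumOver (λ u → X u ∧ B u) f + sumOver (λ u → X u ∧ not (B u)) f
  sumOver-split X B f = trans (sum-cong-≗ pointwise)
    (∑-distrib-+ (λ u → if X u ∧ B u then f u else 0) (λ u → if X u ∧ not (B u) then f u else 0))
    where
    pointwise : ∀ u → (if X u then f u else 0) ≡
                      (if X u ∧ B u then f u else 0) + (if X u ∧ not (B u) then f u else 0)
    pointwise u with X u | B u
    ... | true  | true  = sym (+-identityʳ (f u))
    ... | true  | false = refl
    ... | false | _     = refl

  sumOver-⊆ : {A B : Fin n → Bool} (f : Fin n → ℕ) →
              (∀ u → A u ≡ true → B u ≡ true) → sumOver A f ≤ sumOver B f
  sumOver-⊆ {A = A} {B} f A⊆B = sum-mono-≤ pointwise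
    where
    pointwise : ∀ u → (if A u then f u else 0) ≤ (if B u then f u else 0)
    pointwise u with A u | A⊆B u
    ... | true  | Bu rewrite Bu refl = ≤-refl
    ... | false | _                 = z≤n

  sumOver-const : (X : Fin n → Bool) (c : ℕ) → ∑[ u ∈ X ] c ≡ count X * c
  sumOver-const {zero}  X c = refl
  sumOver-const {suc n} X c with X zero
  ... | true  = cong (c +_) (sumOver-const (λ u → X (suc u)) c)
  ... | false = sumOver-const (λ u → X (suc u)) c

  sumOver≡0 : {X : Fin n → Bool} {f : Fin n → ℕ} → sumOver X f ≡ 0 → ∀ u → X u ≡ true → f u ≡ 0
  sumOver≡0 {X = X} {f} eq u Xu = sym (sumOver-tight (λ _ _ → z≤n) 0≡sum u Xu)
    where
    0≡sum : ∑[ u ∈ X ] 0 ≡ sumOver X f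
    0≡sum = trans (trans (sumOver-const X 0) (*-zeroʳ (count X))) (sym eq)

  count-cong : {A B : Fin n → Bool} → (∀ u → A u ≡ B u) → count A ≡ count B
  count-cong A≡B = sum-cong-≗ (λ u → cong 𝟙 (A≡B u))

  count-all : count {n} (λ _ → true) ≡ n
  count-all {zero}  = refl
  count-all {suc n} = cong suc (count-all {n})

  count-complement : (X : Fin n → Bool) → count X + count (λ u → not (X u)) ≡ n
  count-complement X = trans (sym (sumOver-split (λ _ → true) X (λ _ → 1))) count-all

  absent⇒count≡0 : {X : Fin n → Bool} → (∀ u → X u ≡ false) → count X ≡ 0
  absent⇒count≡0 {n} absent = trans (sum-cong-≗ (λ u → cong 𝟙 (absent u))) (sum-replicate-zero n)

  count-⊆-tight : {A B : Fin n → Bool} → (∀ u → A u ≡ true → B u ≡ true) →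
                  count A ≡ count B → ∀ u → B u ≡ true → A u ≡ true
  count-⊆-tight {A = A} {B} A⊆B eq u Bu = 𝟙≡1⇒true (trans (sum-tight pointwise eq u) (cong 𝟙 Bu))
    where
    pointwise : ∀ u → 𝟙 (A u) ≤ 𝟙 (B u)
    pointwise u with A u | A⊆B u
    ... | true  | Bu rewrite Bu refl = ≤-refl
    ... | false | _                 = z≤n
    𝟙≡1⇒true : ∀ {b} → 𝟙 b ≡ 1 → b ≡ true
    𝟙≡1⇒true {true} _ = refl

  count-singleton : (v : Fin n) (Q : Fin n → Bool) → count (λ u → does (u ≟ v) ∧ Q u) ≡ 𝟙 (Q v)
  count-singleton {suc n} zero Q =
    trans (cong (𝟙 (Q zero) +_) (absent⇒count≡0 {X = λ u → false ∧ Q (suc u)} (λ _ → refl)))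
          (+-identityʳ _)
  count-singleton {suc n} (suc v) Q = count-singleton v (λ u → Q (suc u))

  double-counting : (R : Fin n → Fin n → Bool) (X Y : Fin n → Bool) →
                    ∑[ u ∈ X ] count (λ w → R w u ∧ Y w) ≡ ∑[ w ∈ Y ] count (λ u → R w u ∧ X u)
  double-counting R X Y = begin
    ∑[ u ∈ X ] count (λ w → R w u ∧ Y w)
      ≡⟨ sum-cong-≗ (λ u → restrict (X u) (λ w → R w u ∧ Y w)) ⟩
    sum (λ u → sum (λ w → 𝟙 (X u ∧ (R w u ∧ Y w))))
      ≡⟨ ∑-comm (λ u w → 𝟙 (X u ∧ (R w u ∧ Y w))) ⟩
    sum (λ w → sum (λ u → 𝟙 (X u ∧ (R w u ∧ Y w))))
      ≡⟨ sum-cong-≗ (λ w → sum-cong-≗ (λ u → cong 𝟙 (swap (X u) (R w u) (Y w)))) ⟩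
    sum (λ w → sum (λ u → 𝟙 (Y w ∧ (R w u ∧ X u))))
      ≡⟨ sum-cong-≗ (λ w → restrict (Y w) (λ u → R w u ∧ X u)) ⟨
    ∑[ w ∈ Y ] count (λ u → R w u ∧ X u) ∎
    where
    open ≡-Reasoning
    restrict : ∀ b (Q : Fin n → Bool) → (if b then count Q else 0) ≡ count (λ w → b ∧ Q w)
    restrict true  Q = refl
    restrict false Q = sym (absent⇒count≡0 {X = λ w → false ∧ Q w} (λ _ → refl))
    swap : ∀ x r y → x ∧ (r ∧ y) ≡ y ∧ (r ∧ x)
    swap true  r true  = refl
    swap true  r false = ∧-zeroʳ r
    swap false r true  = sym (∧-zeroʳ r)
    swap false r false = refl

  rank : (Fin n → Bool) → Fin n → ℕ
  rank X zero    = 0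
  rank X (suc u) = 𝟙 (X zero) + rank (λ w → X (suc w)) u

  rank<count : (X : Fin n → Bool) {u : Fin n} → X u ≡ true → rank X u < count X
  rank<count X {zero}  Xu rewrite Xu = s≤s z≤n
  rank<count X {suc u} Xu = +-monoʳ-< (𝟙 (X zero)) (rank<count (λ w → X (suc w)) Xu)

  rank-injective : (X : Fin n → Bool) {u w : Fin n} → X u ≡ true → X w ≡ true →
                   rank X u ≡ rank X w → u ≡ w
  rank-injective X {zero}  {zero}  _  _  _ = refl
  rank-injective X {zero}  {suc w} Xu _  eq rewrite Xu with () ← eq
  rank-injective X {suc u} {zero}  _  Xw eq rewrite Xw with () ← eq
  rank-injective X {suc u} {suc w} Xu Xw eq =
    cong suc (rank-injective (λ v → X (suc v)) Xu Xw (+-cancelˡ-≡ (𝟙 (X zero)) _ _ eq))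

  rank-surjective : (X : Fin n → Bool) {j : ℕ} → j < count X → ∃ λ u → X u ≡ true × rank X u ≡ j
  rank-surjective {suc n} X {j} j<count with X zero in X0
  rank-surjective {suc n} X {zero}  _ | true = zero , X0 , refl
  rank-surjective {suc n} X {suc j} (s≤s j<count) | true
    with u , Xu , rank≡j ← rank-surjective (λ v → X (suc v)) j<count
    = suc u , Xu , trans (cong (λ b → 𝟙 b + rank (λ v → X (suc v)) u) X0) (cong suc rank≡j)
  rank-surjective {suc n} X {j} j<count | false
    with u , Xu , rank≡j ← rank-surjective (λ v → X (suc v)) j<count
    = suc u , Xu , trans (cong (λ b → 𝟙 b + rank (λ v → X (suc v)) u) X0) rank≡j

  member⇒count>0 : (X : Fin n → Bool) {u : Fin n} → X u ≡ true → 0 < count X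
  member⇒count>0 X Xu = ≤-<-trans z≤n (rank<count X Xu)

  count>0⇒member : (X : Fin n → Bool) → 0 < count X → ∃ λ u → X u ≡ true
  count>0⇒member X 0<count with u , Xu , _ ← rank-surjective X 0<count = u , Xu

  count≡0⇒absent : {X : Fin n → Bool} → count X ≡ 0 → ∀ u → X u ≡ false
  count≡0⇒absent {X = X} count≡0 u with X u in Xu
  ... | false = refl
  ... | true  = contradiction (subst (0 <_) count≡0 (member⇒count>0 X Xu)) λ ()

  count≤1⇒unique : (X : Fin n → Bool) → count X ≤ 1 →
                   ∀ {u w} → X u ≡ true → X w ≡ true → u ≡ w
  count≤1⇒unique X count≤1 Xu Xw = rank-injective X Xu Xw (trans (rank≡0 Xu) (sym (rank≡0 Xw)))
    where
    rank≡0 : ∀ {v} → X v ≡ true → rank X v ≡ 0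
    rank≡0 Xv = n<1⇒n≡0 (<-≤-trans (rank<count X Xv) count≤1)

  count-injection-≤ : {X : Fin n → Bool} (g : Fin n → Fin c) →
                      (∀ {u w} → X u ≡ true → X w ≡ true → g u ≡ g w → u ≡ w) → count X ≤ c
  count-injection-≤ {X = X} g g-injective = injective⇒≤ {f = λ j → g (member j)} member-injective
    where
    member : Fin (count X) → Fin _
    member j = proj₁ (rank-surjective X (toℕ<n j))
    member-injective : ∀ {i j} → g (member i) ≡ g (member j) → i ≡ j
    member-injective {i} {j} eq
      with u , Xu , rank≡i ← rank-surjective X (toℕ<n i)
         | w , Xw , rank≡j ← rank-surjective X (toℕ<n j)
      = toℕ-injective (trans (sym rank≡i) (trans (cong (rank X) (g-injective Xu Xw eq)) rank≡j))

  count-injection-≥ : {X : Fin n → Bool} (h : Fin c → Fin n) → (∀ i → X (h i) ≡ true) →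
                      (∀ {i j} → h i ≡ h j → i ≡ j) → c ≤ count X
  count-injection-≥ {X = X} h X∘h h-injective = injective⇒≤ {f = position} position-injective
    where
    position : Fin _ → Fin (count X)
    position i = fromℕ< (rank<count X (X∘h i))
    position-injective : ∀ {i j} → position i ≡ position j → i ≡ j
    position-injective {i} {j} eq = h-injective (rank-injective X (X∘h i) (X∘h j)
      (trans (sym (toℕ-fromℕ< _)) (trans (cong toℕ eq) (toℕ-fromℕ< _))))

  -- The reduction mod d only makes index total; on members of X it is the rank when count X ≡ d.
  index : (X : Fin n → Bool) (d : ℕ) .{{_ : NonZero d}} → Fin n → Fin d
  index X d u = rank X u mod d

  toℕ-index : (X : Fin n → Bool) {d : ℕ} .{{_ : NonZero d}} {u : Fin n} →
              X u ≡ true → count X ≡ d → toℕ (index X d u) ≡ rank X u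
  toℕ-index X Xu count≡d =
    trans (toℕ-fromℕ< _) (m<n⇒m%n≡m (subst (_ <_) count≡d (rank<count X Xu)))

  choose : (Fin n → Bool) → Fin n → Fin n
  choose X default with any? (λ u → X u Bool.≟ true)
  ... | yes (u , _) = u
  ... | no  _       = default

  choose-member : (X : Fin n → Bool) (default : Fin n) {u : Fin n} →
                  X u ≡ true → X (choose X default) ≡ true
  choose-member X default {u} Xu with any? (λ u → X u Bool.≟ true)
  ... | yes (_ , Xw) = Xw
  ... | no  none     = contradiction (u , Xu) none

  argmax : (X : Fin n → Bool) (g : Fin n → ℕ) →
           (∀ u → X u ≡ false) ⊎ ∃ λ v → X v ≡ true × (∀ u → X u ≡ true → g u ≤ g v)
  argmax {zero}  X g = inj₁ λ ()
  argmax {suc n} X g with argmax (λ u → X (suc u)) (λ u → g (suc u)) | X zero in X0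
  ... | inj₁ none | false = inj₁ λ { zero → X0 ; (suc u) → none u }
  ... | inj₁ none | true  =
    inj₂ (zero , X0 , λ { zero _ → ≤-refl ; (suc u) Xu → contradiction (trans (sym Xu) (none u)) λ () })
  ... | inj₂ (v , Xv , max) | false =
    inj₂ (suc v , Xv , λ { zero X0′ → contradiction (trans (sym X0) X0′) λ () ; (suc u) → max u })
  ... | inj₂ (v , Xv , max) | true with g zero ≤? g (suc v)
  ...   | yes g0≤ = inj₂ (suc v , Xv , λ { zero _ → g0≤ ; (suc u) → max u })
  ...   | no  g0≰ =
    inj₂ (zero , X0 , λ { zero _ → ≤-refl ; (suc u) Xu → ≤-trans (max u Xu) (<⇒≤ (≰⇒> g0≰)) })

module Turán where

  open import Data.Bool using (Bool; true; false; if_then_else_; _∧_; not)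
  open import Data.Bool.Properties using (∧-comm; ∧-assoc; ∧-identityʳ; ∧-zeroʳ; ∧-conicalˡ; ∧-conicalʳ)
  open import Data.Empty using (⊥-elim)
  open import Data.Fin using (Fin; zero; suc; _≟_)
  open import Data.Fin.Properties using (suc-injective)
  open import Data.Nat hiding (_≟_)
  open import Data.Nat.Properties hiding (_≟_; suc-injective)
  open import Data.Product using (Σ; ∃; _×_; _,_; proj₁; proj₂)
  open import Data.Sum using (inj₁; inj₂)
  open import Defs using (adj)
  open import Function.Bundles using (_⇔_; mk⇔; Equivalence)
  open import Relation.Binary.PropositionalEquality
  open import Relation.Nullary using (¬_; does; contradiction)
  open Arithmetic
  open Counting

  module Degrees {n} (G : Graph n) where

    deg : (Fin n → Bool) → Fin n → ℕ
    deg Y v = count λ u → adj G u v ∧ Y u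

    -- Counts ordered adjacent pairs, so e[ S , S ] is twice the number of edges inside S.
    e[_,_] : (Fin n → Bool) → (Fin n → Bool) → ℕ
    e[ X , Y ] = ∑[ v ∈ X ] deg Y v

    e-comm : ∀ X Y → e[ X , Y ] ≡ e[ Y , X ]
    e-comm X Y = trans (double-counting (adj G) X Y)
                       (sumOver-cong (λ w _ → count-cong (λ u → cong (_∧ X u) (Graph.sym G w u))))

    deg-mono : ∀ {Y Z} → (∀ u → Y u ≡ true → Z u ≡ true) → ∀ v → deg Y v ≤ deg Z v
    deg-mono {Y} {Z} Y⊆Z v = sumOver-⊆ (λ _ → 1) adj∧Y⊆adj∧Z
      where
      adj∧Y⊆adj∧Z : ∀ u → (adj G u v ∧ Y u) ≡ true → (adj G u v ∧ Z u) ≡ true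
      adj∧Y⊆adj∧Z u with adj G u v | Y u in Yu
      ... | true | true = λ _ → Y⊆Z u Yu

    deg-split : ∀ Y B v → deg Y v ≡ deg (λ u → Y u ∧ B u) v + deg (λ u → Y u ∧ not (B u)) v
    deg-split Y B v = trans (sumOver-split (λ u → adj G u v ∧ Y u) B (λ _ → 1))
      (cong₂ _+_ (count-cong (λ u → ∧-assoc (adj G u v) (Y u) (B u)))
                 (count-cong (λ u → ∧-assoc (adj G u v) (Y u) (not (B u)))))

    deg≡0⇒non-adjacent : ∀ {Y v} → deg Y v ≡ 0 → ∀ {u} → Y u ≡ true → adj G u v ≡ false
    deg≡0⇒non-adjacent {Y} {v} deg≡0 {u} Yu =
      trans (sym (∧-identityʳ _)) (trans (cong (adj G u v ∧_) (sym Yu)) (count≡0⇒absent deg≡0 u))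

    e≡0 : ∀ {X Y} → (∀ {u w} → X u ≡ true → Y w ≡ true → adj G w u ≡ false) → e[ X , Y ] ≡ 0
    e≡0 {X} {Y} no-edges = trans (sumOver-cong deg≡0) (trans (sumOver-const X 0) (*-zeroʳ (count X)))
      where
      deg≡0 : ∀ u → X u ≡ true → deg Y u ≡ 0
      deg≡0 u Xu = absent⇒count≡0 λ w → non-edge w (Y w) refl
        where
        non-edge : ∀ w b → Y w ≡ b → (adj G w u ∧ b) ≡ false
        non-edge w true  Yw = trans (∧-identityʳ _) (no-edges Xu Yw)
        non-edge w false _  = ∧-zeroʳ _

    IsClique : ∀ {k} → (Fin k → Fin n) → Set
    IsClique c = ∀ i j → i ≢ j → adj G (c i) (c j) ≡ true

    -- As in Defs.CliqueFree, t is one less than the size of the forbidden clique.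
    CliqueFreeIn : ℕ → (Fin n → Bool) → Set
    CliqueFreeIn t S = ¬ Σ (Fin (suc t) → Fin n) λ c → (∀ i → S (c i) ≡ true) × IsClique c

    cliqueFree⇒cliqueFreeIn : ∀ {t} → CliqueFree t G → ∀ S → CliqueFreeIn t S
    cliqueFree⇒cliqueFreeIn free S (c , _ , clique) = free (c , clique)

    cliqueFreeIn-1⇒independent : ∀ {S} → CliqueFreeIn 1 S →
                                 ∀ {u w} → S u ≡ true → S w ≡ true → adj G u w ≡ false
    cliqueFreeIn-1⇒independent {S} free {u} {w} Su Sw with adj G u w in uw
    ... | false = refl
    ... | true  = ⊥-elim (free (edge , (λ { zero → Su ; (suc zero) → Sw }) , clique))
      where
      edge : Fin 2 → Fin n
      edge zero       = u
      edge (suc zero) = w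
      clique : IsClique edge
      clique zero       zero       0≢0 = contradiction refl 0≢0
      clique zero       (suc zero) _   = uw
      clique (suc zero) zero       _   = trans (Graph.sym G w u) uw
      clique (suc zero) (suc zero) 1≢1 = contradiction refl 1≢1

    cliqueFreeIn-neighbourhood : ∀ {t S v} → S v ≡ true → CliqueFreeIn (suc t) S →
                                 CliqueFreeIn t (λ w → S w ∧ adj G w v)
    cliqueFreeIn-neighbourhood {t} {S} {v} Sv free (c , inside , clique) = free (c′ , inside′ , clique′)
      where
      c′ : Fin (suc (suc t)) → Fin n
      c′ zero    = v
      c′ (suc i) = c i
      inside′ : ∀ i → S (c′ i) ≡ true
      inside′ zero    = Sv
      inside′ (suc i) = ∧-conicalˡ _ _ (inside i)
      adjacent-to-v : ∀ i → adj G (c i) v ≡ true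
      adjacent-to-v i = ∧-conicalʳ _ _ (inside i)
      clique′ : IsClique c′
      clique′ zero    zero    0≢0 = contradiction refl 0≢0
      clique′ zero    (suc j) _   = trans (Graph.sym G v (c j)) (adjacent-to-v j)
      clique′ (suc i) zero    _   = adjacent-to-v i
      clique′ (suc i) (suc j) i≢j = clique i j (λ i≡j → i≢j (cong suc i≡j))

  module _ {n} (G : Graph n) where
    open Degrees G

    record BalancedCompleteMultipartite (t p : ℕ) (S : Fin n → Bool) : Set where
      field
        part      : Fin n → Fin t
        part-size : ∀ i → count (λ u → S u ∧ does (part u ≟ i)) ≡ p
        size      : count S ≡ t * p
        adj⇔      : ∀ {u w} → S u ≡ true → S w ≡ true → adj G u w ≡ true ⇔ part u ≢ part w

    empty-multipartite : ∀ {t S} → (∀ u → S u ≡ false) → BalancedCompleteMultipartite (suc t) 0 S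
    empty-multipartite {t} empty = record
      { part      = λ _ → zero
      ; part-size = λ i → absent⇒count≡0 (λ u → cong (_∧ _) (empty u))
      ; size      = trans (absent⇒count≡0 empty) (sym (*-zeroʳ (suc t)))
      ; adj⇔      = λ {u} Su → contradiction (trans (sym Su) (empty u)) λ ()
      }

    independent-multipartite : ∀ {S} → (∀ {u w} → S u ≡ true → S w ≡ true → adj G u w ≡ false) →
                               BalancedCompleteMultipartite 1 (count S) S
    independent-multipartite {S} independent = record
      { part      = λ _ → zero
      ; part-size = λ { zero → count-cong (λ u → ∧-identityʳ (S u)) }
      ; size      = sym (*-identityˡ (count S))
      ; adj⇔      = λ Su Sw → mk⇔ (λ uw → contradiction (trans (sym uw) (independent Su Sw)) λ ())
                                  (λ 0≢0 → contradiction refl 0≢0)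
      }

    module _ (S B : Fin n → Bool) where
      private
        N R : Fin n → Bool
        N u = S u ∧ B u
        R u = S u ∧ not (B u)

        in-N : ∀ {u} → S u ≡ true → B u ≡ true → N u ≡ true
        in-N = cong₂ _∧_

        in-R : ∀ {u} → S u ≡ true → B u ≡ false → R u ≡ true
        in-R = cong₂ (λ a b → a ∧ not b)

      add-independent-part : ∀ {t p} → BalancedCompleteMultipartite t p N → count R ≡ p →
        (∀ {u w} → R u ≡ true → R w ≡ true → adj G u w ≡ false) →
        (∀ {u w} → R u ≡ true → N w ≡ true → adj G u w ≡ true) →
        BalancedCompleteMultipartite (suc t) p S
      add-independent-part {t} {p} K count-R R-independent R-N-complete = record
        { part      = part′
        ; part-size = part-size′
        ; size      = trans (sumOver-split S B (λ _ → 1)) (trans (cong₂ _+_ size count-R) (+-comm (t * p) p))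
        ; adj⇔      = adj⇔′
        }
        where
        open BalancedCompleteMultipartite K

        part′ : Fin n → Fin (suc t)
        part′ u = if B u then suc (part u) else zero

        part-size′ : ∀ i → count (λ u → S u ∧ does (part′ u ≟ i)) ≡ p
        part-size′ zero    = trans (count-cong pointwise) count-R
          where
          pointwise : ∀ u → (S u ∧ does (part′ u ≟ zero)) ≡ R u
          pointwise u with B u
          ... | true  = refl
          ... | false = refl
        part-size′ (suc i) = trans (count-cong pointwise) (part-size i)
          where
          pointwise : ∀ u → (S u ∧ does (part′ u ≟ suc i)) ≡ (N u ∧ does (part u ≟ i))
          pointwise u with S u | B u
          ... | true  | true  = refl
          ... | true  | false = refl
          ... | false | _     = refl

        adj⇔′ : ∀ {u w} → S u ≡ true → S w ≡ true → adj G u w ≡ true ⇔ part′ u ≢ part′ w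
        adj⇔′ {u} {w} Su Sw with B u in Bu | B w in Bw
        ... | true  | true  = mk⇔ (λ uw eq → Equivalence.to (adj⇔ Nu Nw) uw (suc-injective eq))
                                  (λ ≢ → Equivalence.from (adj⇔ Nu Nw) (λ eq → ≢ (cong suc eq)))
          where
          Nu : N u ≡ true
          Nu = in-N Su Bu
          Nw : N w ≡ true
          Nw = in-N Sw Bw
        ... | true  | false =
          mk⇔ (λ _ ()) (λ _ → trans (Graph.sym G u w) (R-N-complete (in-R Sw Bw) (in-N Su Bu)))
        ... | false | true  = mk⇔ (λ _ ()) (λ _ → R-N-complete (in-R Su Bu) (in-N Sw Bw))
        ... | false | false =
          mk⇔ (λ uw → contradiction (trans (sym uw) (R-independent (in-R Su Bu) (in-R Sw Bw))) λ ())
              (λ 0≢0 → contradiction refl 0≢0)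

    -- Erdős' proof of Turán's theorem: split S at a vertex v of maximum degree into its
    -- neighbourhood N, which is clique-free of one size less, and the rest R.
    module MaxDegreeSplit (S : Fin n → Bool) (v : Fin n) (max : ∀ u → S u ≡ true → deg S u ≤ deg S v) where
      N R : Fin n → Bool
      N u = S u ∧ adj G u v
      R u = S u ∧ not (adj G u v)

      N⊆S : ∀ u → N u ≡ true → S u ≡ true
      N⊆S u = ∧-conicalˡ (S u) _

      R⊆S : ∀ u → R u ≡ true → S u ≡ true
      R⊆S u = ∧-conicalˡ (S u) _

      count-S : count S ≡ count N + count R
      count-S = sumOver-split S (λ u → adj G u v) (λ _ → 1)

      count-N : count N ≡ deg S v
      count-N = count-cong (λ u → ∧-comm (S u) (adj G u v))

      e-S : e[ S , S ] ≡ e[ N , N ] + e[ N , R ] + e[ R , S ]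
      e-S = begin
        e[ S , S ]                                    ≡⟨ sumOver-split S (λ u → adj G u v) (deg S) ⟩
        ∑[ u ∈ N ] deg S u + e[ R , S ]               ≡⟨ cong (_+ e[ R , S ]) (sumOver-cong split-deg) ⟩
        ∑[ u ∈ N ] (deg N u + deg R u) + e[ R , S ]   ≡⟨ cong (_+ e[ R , S ]) (sumOver-+ N (deg N) (deg R)) ⟩
        e[ N , N ] + e[ N , R ] + e[ R , S ]          ∎
        where
        open ≡-Reasoning
        split-deg : ∀ u → N u ≡ true → deg S u ≡ deg N u + deg R u
        split-deg u _ = deg-split S (λ w → adj G w v) u

      e-NR≤e-RS : e[ N , R ] ≤ e[ R , S ]
      e-NR≤e-RS = subst (_≤ e[ R , S ]) (e-comm R N) (sumOver-mono-≤ (λ u _ → deg-mono N⊆S u))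

      e-RS≤ : e[ R , S ] ≤ count R * count N
      e-RS≤ = begin
        e[ R , S ]          ≤⟨ sumOver-mono-≤ (λ u Ru → max u (R⊆S u Ru)) ⟩
        ∑[ u ∈ R ] deg S v  ≡⟨ sumOver-const R (deg S v) ⟩
        count R * deg S v   ≡⟨ cong (count R *_) count-N ⟨
        count R * count N   ∎
        where
        open ≤-Reasoning

    turán : ∀ s S → CliqueFreeIn (suc s) S → suc s * e[ S , S ] ≤ s * (count S * count S)
    turán zero    S free =
      ≤-reflexive (trans (+-identityʳ _) (e≡0 λ Su Sw → cliqueFreeIn-1⇒independent free Sw Su))
    turán (suc s) S free with argmax S (deg S)
    ... | inj₁ empty rewrite e≡0 {S} {S} (λ {u} Su → contradiction (trans (sym Su) (empty u)) λ ())
                           | *-zeroʳ (suc (suc s)) = z≤n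
    ... | inj₂ (v , Sv , max) = subst (λ k → suc (suc s) * e[ S , S ] ≤ suc s * (k * k)) (sym count-S)
      (TuránStep.bound s {x = count N} {c = count R} e-S e-NR≤e-RS e-RS≤ (turán s N free′))
      where
      open MaxDegreeSplit S v max
      free′ : CliqueFreeIn (suc s) N
      free′ = cliqueFreeIn-neighbourhood Sv free

    turán-tight : ∀ s S → CliqueFreeIn (suc s) S → suc s * e[ S , S ] ≡ s * (count S * count S) →
                  ∃ λ p → BalancedCompleteMultipartite (suc s) p S
    turán-tight zero    S free _  = _ , independent-multipartite (cliqueFreeIn-1⇒independent free)
    turán-tight (suc s) S free eq with argmax S (deg S)
    ... | inj₁ empty = _ , empty-multipartite empty
    ... | inj₂ (v , Sv , max) =
      p , add-independent-part S (λ u → adj G u v) K count-R R-independent R-N-complete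
      where
      open MaxDegreeSplit S v max

      free′ : CliqueFreeIn (suc s) N
      free′ = cliqueFreeIn-neighbourhood Sv free

      eq′ : suc (suc s) * e[ S , S ] ≡ suc s * ((count N + count R) * (count N + count R))
      eq′ = trans eq (cong (λ k → suc s * (k * k)) count-S)

      open TuránStep.Tight s {x = count N} {c = count R} e-S e-NR≤e-RS e-RS≤ (turán s N free′) eq′

      p : ℕ
      p = proj₁ (turán-tight s N free′ IH-tight)

      K : BalancedCompleteMultipartite (suc s) p N
      K = proj₂ (turán-tight s N free′ IH-tight)

      count-R : count R ≡ p
      count-R = *-cancelˡ-≡ _ _ (suc s) (trans (sym x≡tc) (BalancedCompleteMultipartite.size K))

      deg-R≡0 : ∀ {w} → R w ≡ true → deg R w ≡ 0
      deg-R≡0 {w} Rw = +-cancelˡ-≡ (deg N w) _ 0 (begin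
        deg N w + deg R w  ≡⟨ deg-split S (λ u → adj G u v) w ⟨
        deg S w            ≡⟨ deg-N≡deg-S ⟨
        deg N w            ≡⟨ +-identityʳ _ ⟨
        deg N w + 0        ∎)
        where
        open ≡-Reasoning
        deg-N≡deg-S : deg N w ≡ deg S w
        deg-N≡deg-S = sumOver-tight (λ u _ → deg-mono N⊆S u) (trans (e-comm R N) X≡Y) w Rw

      R-independent : ∀ {u w} → R u ≡ true → R w ≡ true → adj G u w ≡ false
      R-independent Ru Rw = deg≡0⇒non-adjacent (deg-R≡0 Rw) Ru

      R-N-complete : ∀ {u w} → R u ≡ true → N w ≡ true → adj G u w ≡ true
      R-N-complete {u} {w} Ru Nw = trans (Graph.sym G u w)
        (∧-conicalˡ _ _ (count-⊆-tight (λ w → ∧-conicalʳ (adj G w u) (N w)) deg-N≡count-N w Nw))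
        where
        open ≡-Reasoning
        deg-S≡Δ : deg S u ≡ deg S v
        deg-S≡Δ = sumOver-tight (λ u Ru → max u (R⊆S u Ru))
          (trans Y≡cx (trans (cong (count R *_) count-N) (sym (sumOver-const R (deg S v))))) u Ru
        deg-N≡count-N : deg N u ≡ count N
        deg-N≡count-N = begin
          deg N u            ≡⟨ +-identityʳ _ ⟨
          deg N u + 0        ≡⟨ cong (deg N u +_) (deg-R≡0 Ru) ⟨
          deg N u + deg R u  ≡⟨ deg-split S (λ w → adj G w v) u ⟨
          deg S u            ≡⟨ deg-S≡Δ ⟩
          deg S v            ≡⟨ count-N ⟨
          count N            ∎

module SignedDomination where

  open import Data.Bool using (Bool; true; false; _∧_; not)
  open import Data.Fin using (Fin; zero; suc; _≟_)
  open import Data.Integer as ℤ using (+_; -_; +[1+_]; 0ℤ; 1ℤ; +≤+)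
  import Data.Integer.Properties as ℤ
  open import Data.Integer.Tactic.RingSolver using (solve-∀)
  open import Data.Nat hiding (_≟_)
  open import Data.Nat.Properties hiding (_≟_)
  open import Algebra.Properties.CommutativeMonoid.Sum +-0-commutativeMonoid using (sum; ∑-distrib-+)
  open import Data.Product using (∃; _×_; _,_; proj₁; proj₂)
  open import Data.Sum using (_⊎_; inj₁; inj₂)
  open import Defs using (adj; sumFin; closedNbhdSum; IsNNSDF)
  open import Function.Bundles using (_⇔_; mk⇔; Equivalence)
  open import Relation.Binary.PropositionalEquality
  open import Relation.Nullary using (yes; no; does)
  open Arithmetic
  open Counting
  open Turán

  sumFin-cong : ∀ {n} {g h : Fin n → ℤ} → (∀ u → g u ≡ h u) → sumFin g ≡ sumFin h
  sumFin-cong {zero}  g≡h = refl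
  sumFin-cong {suc n} g≡h = cong₂ ℤ._+_ (g≡h zero) (sumFin-cong (λ u → g≡h (suc u)))

  sumFin-difference : ∀ {n} (a b : Fin n → ℕ) → sumFin (λ u → + a u ℤ.- + b u) ≡ + sum a ℤ.- + sum b
  sumFin-difference {zero}  a b = refl
  sumFin-difference {suc n} a b = begin
    (+ a zero ℤ.- + b zero) ℤ.+ sumFin (λ u → + a (suc u) ℤ.- + b (suc u))
      ≡⟨ cong (λ z → (+ a zero ℤ.- + b zero) ℤ.+ z) (sumFin-difference (λ u → a (suc u)) (λ u → b (suc u))) ⟩
    (+ a zero ℤ.- + b zero) ℤ.+ (+ sum (λ u → a (suc u)) ℤ.- + sum (λ u → b (suc u)))
      ≡⟨ regroup (+ a zero) (+ b zero) (+ sum (λ u → a (suc u))) (+ sum (λ u → b (suc u))) ⟩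
    (+ a zero ℤ.+ + sum (λ u → a (suc u))) ℤ.- (+ b zero ℤ.+ + sum (λ u → b (suc u)))
      ≡⟨ cong₂ ℤ._-_ (ℤ.pos-+ (a zero) _) (ℤ.pos-+ (b zero) _) ⟨
    + sum a ℤ.- + sum b ∎
    where
    open ≡-Reasoning
    regroup : ∀ a b c d → (a ℤ.- b) ℤ.+ (c ℤ.- d) ≡ (a ℤ.+ c) ℤ.- (b ℤ.+ d)
    regroup = solve-∀

  isPositive : ℤ → Bool
  isPositive +[1+ _ ] = true
  isPositive _        = false

  module SignedFunction {n} (G : Graph n) (f : Fin n → ℤ) (±1 : ∀ v → f v ≡ 1ℤ ⊎ f v ≡ - 1ℤ) where
    open Degrees G

    P M : Fin n → Bool
    P u = isPositive (f u)
    M u = not (P u)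

    f≡ : ∀ u → f u ≡ + 𝟙 (P u) ℤ.- + 𝟙 (M u)
    f≡ u with ±1 u
    ... | inj₁ f≡1  rewrite f≡1  = refl
    ... | inj₂ f≡-1 rewrite f≡-1 = refl

    sumFin≡ : sumFin f ≡ + count P ℤ.- + count M
    sumFin≡ = trans (sumFin-cong f≡) (sumFin-difference (λ u → 𝟙 (P u)) (λ u → 𝟙 (M u)))

    closed-count : ∀ v Q → sum (λ u → 𝟙 (does (u ≟ v) ∧ Q u) + 𝟙 (adj G u v ∧ Q u)) ≡ 𝟙 (Q v) + deg Q v
    closed-count v Q = trans (∑-distrib-+ (λ u → 𝟙 (does (u ≟ v) ∧ Q u)) (λ u → 𝟙 (adj G u v ∧ Q u)))
                             (cong (_+ deg Q v) (count-singleton v Q))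

    module _ (v : Fin n) where
      mutual
        closedNbhdSum≡ : closedNbhdSum G f v ≡ + (𝟙 (P v) + deg P v) ℤ.- + (𝟙 (M v) + deg M v)
        closedNbhdSum≡ =
          trans (sumFin-cong summand)
                (trans (sumFin-difference (λ u → 𝟙 (does (u ≟ v) ∧ P u) + 𝟙 (adj G u v ∧ P u))
                                          (λ u → 𝟙 (does (u ≟ v) ∧ M u) + 𝟙 (adj G u v ∧ M u)))
                       (cong₂ (λ a b → + a ℤ.- + b) (closed-count v P) (closed-count v M)))

        -- The summand of closedNbhdSum is local to its where block, so it is left to unification.
        summand : ∀ u → _ ≡ + (𝟙 (does (u ≟ v) ∧ P u) + 𝟙 (adj G u v ∧ P u))
                            ℤ.- + (𝟙 (does (u ≟ v) ∧ M u) + 𝟙 (adj G u v ∧ M u))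
        summand u with u ≟ v
        ... | yes refl rewrite Graph.irrefl G u with ±1 u
        ...   | inj₁ f≡1  rewrite f≡1  = refl
        ...   | inj₂ f≡-1 rewrite f≡-1 = refl
        summand u | no _ with adj G u v | ±1 u
        ... | false | _         = refl
        ... | true  | inj₁ f≡1  rewrite f≡1  = refl
        ... | true  | inj₂ f≡-1 rewrite f≡-1 = refl

    nonnegative⇔ : ∀ v → 0ℤ ℤ.≤ closedNbhdSum G f v ⇔ 𝟙 (M v) + deg M v ≤ 𝟙 (P v) + deg P v
    nonnegative⇔ v rewrite closedNbhdSum≡ v =
      mk⇔ (λ 0≤ → ℤ.drop‿+≤+ (ℤ.0≤i-j⇒j≤i 0≤)) (λ ≤ → ℤ.i≤j⇒0≤j-i (+≤+ ≤))

  module NonnegativeSignedDomination {n} (G : Graph n) (f : Fin n → ℤ) (nnsdf : IsNNSDF G f) where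
    open Degrees G
    open SignedFunction G f (proj₁ nnsdf) public

    M-local : ∀ v → M v ≡ true → suc (deg M v) ≤ deg P v
    M-local v Mv with P v | Equivalence.to (nonnegative⇔ v) (proj₂ nnsdf v)
    ... | false | local = local

    P-local : ∀ v → P v ≡ true → deg M v ≤ suc (deg P v)
    P-local v Pv with P v | Equivalence.to (nonnegative⇔ v) (proj₂ nnsdf v)
    ... | true | local = local

    M-sum : count M + e[ M , M ] ≤ e[ M , P ]
    M-sum = subst (_≤ e[ M , P ]) (sumOver-+ M (λ _ → 1) (deg M)) (sumOver-mono-≤ M-local)

    P-sum : e[ P , M ] ≤ count P + e[ P , P ]
    P-sum = subst (e[ P , M ] ≤_) (sumOver-+ P (λ _ → 1) (deg P)) (sumOver-mono-≤ P-local)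

    e-MP≤ : e[ M , P ] ≤ count P + e[ P , P ]
    e-MP≤ = ≤-trans (≤-reflexive (e-comm M P)) P-sum

    module _ (s : ℕ) (free : CliqueFree (suc s) G) where
      private
        k m : ℕ
        k = count P
        m = count M

        by-domination : suc s * m ≤ suc s * (k + e[ P , P ])
        by-domination = *-monoʳ-≤ (suc s) (≤-trans (m≤m+n m e[ M , M ]) (≤-trans M-sum e-MP≤))

        by-turán : suc s * (k + e[ P , P ]) ≤ suc s * k + s * (k * k)
        by-turán = subst (_≤ suc s * k + s * (k * k)) (sym (*-distribˡ-+ (suc s) k e[ P , P ]))
                         (+-monoʳ-≤ (suc s * k) (turán G s P (cliqueFree⇒cliqueFreeIn free P)))

      bound : suc s * m ≤ suc s * k + s * (k * k)
      bound = ≤-trans by-domination by-turán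

      module Tight (eq : suc s * m ≡ suc s * k + s * (k * k)) where
        private
          squeeze : suc s * m ≡ suc s * (k + e[ P , P ]) × suc s * (k + e[ P , P ]) ≡ suc s * k + s * (k * k)
          squeeze = ≤-squeeze by-domination by-turán eq

          m≡ : m ≡ k + e[ P , P ]
          m≡ = *-cancelˡ-≡ _ _ (suc s) (proj₁ squeeze)

          left : m ≡ m + e[ M , M ] × m + e[ M , M ] ≡ k + e[ P , P ]
          left = ≤-squeeze (m≤m+n m e[ M , M ]) (≤-trans M-sum e-MP≤) m≡

          right : m + e[ M , M ] ≡ e[ M , P ] × e[ M , P ] ≡ k + e[ P , P ]
          right = ≤-squeeze M-sum e-MP≤ (proj₂ left)

          e-MM≡0 : e[ M , M ] ≡ 0
          e-MM≡0 = +-cancelˡ-≡ m _ 0 (trans (sym (proj₁ left)) (sym (+-identityʳ m)))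

        deg-M≡0 : ∀ {w} → M w ≡ true → deg M w ≡ 0
        deg-M≡0 {w} = sumOver≡0 {X = M} {f = deg M} e-MM≡0 w

        M-independent : ∀ {u w} → M u ≡ true → M w ≡ true → adj G u w ≡ false
        M-independent Mu Mw = deg≡0⇒non-adjacent (deg-M≡0 Mw) Mu

        M-pendant : ∀ {u} → M u ≡ true → deg P u ≡ 1
        M-pendant {u} Mu = begin
          deg P u          ≡⟨ sumOver-tight M-local (trans (sumOver-+ M (λ _ → 1) (deg M)) (proj₁ right)) u Mu ⟨
          suc (deg M u)    ≡⟨ cong suc (deg-M≡0 Mu) ⟩
          1                ∎
          where
          open ≡-Reasoning

        P-deg : ∀ {x} → P x ≡ true → deg M x ≡ suc (deg P x)
        P-deg {x} = sumOver-tight P-local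
          (trans (sym (e-comm M P)) (trans (proj₂ right) (sym (sumOver-+ P (λ _ → 1) (deg P))))) x

        P-multipartite : ∃ λ p → BalancedCompleteMultipartite G (suc s) p P
        P-multipartite = turán-tight G s P (cliqueFree⇒cliqueFreeIn free P)
          (+-cancelˡ-≡ (suc s * k) _ _ (trans (sym (*-distribˡ-+ (suc s) k e[ P , P ])) (proj₂ squeeze)))

module Corona where

  open import Data.Bool using (Bool; true; false; if_then_else_; _∧_; not)
  open import Data.Bool.Properties using (∧-conicalˡ; ∧-conicalʳ; ∧-zeroʳ; ∧-identityʳ; not-injective)
  open import Data.Empty using (⊥-elim)
  open import Data.Fin using (Fin; suc; toℕ; fromℕ<; punchIn; _≟_)
  open import Data.Fin.Properties using (toℕ<n; toℕ-injective; *↔×; punchIn-injective; punchInᵢ≢i)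
  open import Data.Integer using (1ℤ; -_)
  open import Data.Maybe using (just; nothing)
  open import Data.Maybe.Properties using (just-injective)
  open import Data.Nat hiding (_≟_)
  open import Data.Nat.Properties hiding (_≟_)
  open import Data.Product using (∃; _×_; _,_; proj₁; proj₂)
  open import Data.Product.Properties using (,-injectiveˡ; ,-injectiveʳ)
  open import Data.Sum using (_⊎_; inj₁; inj₂)
  open import Defs using (adj; CoronaV; CoronaAdj; IsoToCorona; IsNNSDF)
  open import Function.Bundles using (_⇔_; mk⇔; _↔_; mk↔ₛ′; Inverse; Equivalence; Injection)
  open import Function.Properties.Inverse using (↔⇒↣; ↔-sym)
  open import Relation.Binary.PropositionalEquality
  open import Relation.Nullary using (yes; no; does; contradiction)
  open import Relation.Nullary.Decidable using (dec-true)
  open Counting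
  open Turán
  open SignedDomination

  ↔-injective : ∀ {A B : Set} (φ : A ↔ B) {x y : A} → Inverse.to φ x ≡ Inverse.to φ y → x ≡ y
  ↔-injective φ = Injection.injective (↔⇒↣ φ)

  module CoronaFromStructure {n} (G : Graph n) (P : Fin n → Bool) {s p′ : ℕ}
    (K : BalancedCompleteMultipartite G (suc s) (suc p′) P)
    (M-independent : ∀ {u w} → not (P u) ≡ true → not (P w) ≡ true → adj G u w ≡ false)
    (M-pendant : ∀ {u} → not (P u) ≡ true → Degrees.deg G P u ≡ 1)
    (P-deg : ∀ {x} → P x ≡ true → Degrees.deg G (λ u → not (P u)) x ≡ suc (Degrees.deg G P x)) where

    open Degrees G
    open BalancedCompleteMultipartite K

    M : Fin n → Bool
    M u = not (P u)

    p m′ : ℕ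
    p  = suc p′
    m′ = s * p + 1

    private instance
      m′-nonZero : NonZero m′
      m′-nonZero = >-nonZero (subst (0 <_) (+-comm 1 (s * p)) z<s)

    inPart : Fin (suc s) → Fin n → Bool
    inPart i u = P u ∧ does (part u ≟ i)

    inPart-self : ∀ {x} → P x ≡ true → inPart (part x) x ≡ true
    inPart-self {x} Px = cong₂ _∧_ Px (dec-true (part x ≟ part x) refl)

    hub : Fin n → Fin (suc s) × Fin p
    hub x = part x , index (inPart (part x)) p x

    toℕ-hub : ∀ {x} → P x ≡ true → toℕ (proj₂ (hub x)) ≡ rank (inPart (part x)) x
    toℕ-hub {x} Px = toℕ-index (inPart (part x)) (inPart-self Px) (part-size (part x))

    hub-injective : ∀ {x y} → P x ≡ true → P y ≡ true → hub x ≡ hub y → x ≡ y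
    hub-injective {x} {y} Px Py eq = rank-injective (inPart (part x)) (inPart-self Px) y-in-part (begin
      rank (inPart (part x)) x  ≡⟨ toℕ-hub Px ⟨
      toℕ (proj₂ (hub x))       ≡⟨ cong (λ h → toℕ (proj₂ h)) eq ⟩
      toℕ (proj₂ (hub y))       ≡⟨ toℕ-hub Py ⟩
      rank (inPart (part y)) y  ≡⟨ cong (λ i → rank (inPart i) y) (,-injectiveˡ eq) ⟨
      rank (inPart (part x)) y  ∎)
      where
      open ≡-Reasoning
      y-in-part : inPart (part x) y ≡ true
      y-in-part = subst (λ i → inPart i y ≡ true) (sym (,-injectiveˡ eq)) (inPart-self Py)

    hub-surjective : ∀ h → ∃ λ x → P x ≡ true × hub x ≡ h
    hub-surjective (i , j)
      with x , x-in-i , rank≡j ← rank-surjective (inPart i) (subst (toℕ j <_) (sym (part-size i)) (toℕ<n j)) =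
      x , Px , cong₂ _,_ part≡i (toℕ-injective (trans (toℕ-hub Px) rank≡))
      where
      Px : P x ≡ true
      Px = ∧-conicalˡ (P x) _ x-in-i
      part≡i : part x ≡ i
      part≡i with part x ≟ i | ∧-conicalʳ (P x) _ x-in-i
      ... | yes eq | _ = eq
      rank≡ : rank (inPart (part x)) x ≡ toℕ j
      rank≡ = trans (cong (λ i → rank (inPart i) x) part≡i) rank≡j

    deg-P-hub : ∀ {x} → P x ≡ true → deg P x ≡ s * p
    deg-P-hub {x} Px = +-cancelˡ-≡ p _ _ (begin
      p + deg P x
        ≡⟨ cong₂ _+_ (part-size (part x)) (sym (count-cong other-part)) ⟨
      count (inPart (part x)) + count (λ u → P u ∧ not (does (part u ≟ part x)))
        ≡⟨ sumOver-split P (λ u → does (part u ≟ part x)) (λ _ → 1) ⟨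
      count P
        ≡⟨ size ⟩
      suc s * p ∎)
      where
      open ≡-Reasoning
      other-part : ∀ u → (adj G u x ∧ P u) ≡ (P u ∧ not (does (part u ≟ part x)))
      other-part u with P u in Pu | part u ≟ part x
      ... | false | _      = ∧-zeroʳ (adj G u x)
      ... | true  | yes eq = trans (∧-identityʳ _) (non-adjacent (adj G u x) refl)
        where
        non-adjacent : ∀ b → adj G u x ≡ b → b ≡ false
        non-adjacent false _  = refl
        non-adjacent true  ux = contradiction eq (Equivalence.to (adj⇔ Pu Px) ux)
      ... | true  | no  ne = trans (∧-identityʳ _) (Equivalence.from (adj⇔ Pu Px) ne)

    deg-M-hub : ∀ {x} → P x ≡ true → deg M x ≡ m′
    deg-M-hub Px = trans (P-deg Px) (trans (cong suc (deg-P-hub Px)) (+-comm 1 (s * p)))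

    -- For u ∈ M, its only neighbour in P.
    anchor : Fin n → Fin n
    anchor u = choose (λ x → adj G x u ∧ P x) u

    anchor-spec : ∀ {u} → M u ≡ true → (adj G (anchor u) u ∧ P (anchor u)) ≡ true
    anchor-spec {u} Mu
      with x , spec ← count>0⇒member (λ x → adj G x u ∧ P x) (subst (0 <_) (sym (M-pendant Mu)) z<s) =
      choose-member (λ x → adj G x u ∧ P x) u spec

    anchor-P : ∀ {u} → M u ≡ true → P (anchor u) ≡ true
    anchor-P Mu = ∧-conicalʳ _ _ (anchor-spec Mu)

    anchor-adj : ∀ {u} → M u ≡ true → adj G (anchor u) u ≡ true
    anchor-adj Mu = ∧-conicalˡ _ _ (anchor-spec Mu)

    anchor-unique : ∀ {u x} → M u ≡ true → adj G x u ≡ true → P x ≡ true → x ≡ anchor u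
    anchor-unique {u} Mu xu Px =
      count≤1⇒unique (λ x → adj G x u ∧ P x) (≤-reflexive (M-pendant Mu)) (cong₂ _∧_ xu Px) (anchor-spec Mu)

    pendantsAt : Fin n → Fin n → Bool
    pendantsAt x u = adj G u x ∧ M u

    pendant-of-anchor : ∀ {u} → M u ≡ true → pendantsAt (anchor u) u ≡ true
    pendant-of-anchor {u} Mu = cong₂ _∧_ (trans (Graph.sym G u (anchor u)) (anchor-adj Mu)) Mu

    leaf : Fin n → Fin m′
    leaf u = index (pendantsAt (anchor u)) m′ u

    toℕ-leaf : ∀ {u} → M u ≡ true → toℕ (leaf u) ≡ rank (pendantsAt (anchor u)) u
    toℕ-leaf {u} Mu = toℕ-index (pendantsAt (anchor u)) (pendant-of-anchor Mu) (deg-M-hub (anchor-P Mu))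

    label : Fin n → CoronaV (suc s) p m′
    label u = if P u then (hub u , nothing) else (hub (anchor u) , just (leaf u))

    label-hub : ∀ {u} → P u ≡ true → label u ≡ (hub u , nothing)
    label-hub Pu rewrite Pu = refl

    label-leaf : ∀ {u} → P u ≡ false → label u ≡ (hub (anchor u) , just (leaf u))
    label-leaf Pu rewrite Pu = refl

    label-injective : ∀ {u w} → label u ≡ label w → u ≡ w
    label-injective {u} {w} eq with P u in Pu | P w in Pw
    ... | true  | true  = hub-injective Pu Pw (,-injectiveˡ eq)
    ... | true  | false with () ← ,-injectiveʳ eq
    ... | false | true  with () ← ,-injectiveʳ eq
    ... | false | false = rank-injective (pendantsAt (anchor u)) (pendant-of-anchor Mu) w-pendant (begin
      rank (pendantsAt (anchor u)) u  ≡⟨ toℕ-leaf Mu ⟨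
      toℕ (leaf u)                    ≡⟨ cong toℕ (just-injective (,-injectiveʳ eq)) ⟩
      toℕ (leaf w)                    ≡⟨ toℕ-leaf Mw ⟩
      rank (pendantsAt (anchor w)) w  ≡⟨ cong (λ x → rank (pendantsAt x) w) same-anchor ⟨
      rank (pendantsAt (anchor u)) w  ∎)
      where
      open ≡-Reasoning
      Mu : M u ≡ true
      Mu = cong not Pu
      Mw : M w ≡ true
      Mw = cong not Pw
      same-anchor : anchor u ≡ anchor w
      same-anchor = hub-injective (anchor-P Mu) (anchor-P Mw) (,-injectiveˡ eq)
      w-pendant : pendantsAt (anchor u) w ≡ true
      w-pendant = subst (λ x → pendantsAt x w ≡ true) (sym same-anchor) (pendant-of-anchor Mw)

    label-surjective : ∀ c → ∃ λ u → label u ≡ c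
    label-surjective (h , nothing) with x , Px , hub≡h ← hub-surjective h =
      x , trans (label-hub Px) (cong (_, nothing) hub≡h)
    label-surjective (h , just l) with x , Px , hub≡h ← hub-surjective h
      with w , w-pendant , rank≡l ← rank-surjective (pendantsAt x) (subst (toℕ l <_) (sym (deg-M-hub Px)) (toℕ<n l)) =
      w , trans (label-leaf (not-injective Mw)) (cong₂ (λ x l → (x , just l)) hub≡ leaf≡l)
      where
      Mw : M w ≡ true
      Mw = ∧-conicalʳ _ _ w-pendant
      anchor≡x : anchor w ≡ x
      anchor≡x = sym (anchor-unique Mw (trans (Graph.sym G x w) (∧-conicalˡ _ _ w-pendant)) Px)
      hub≡ : hub (anchor w) ≡ h
      hub≡ = trans (cong hub anchor≡x) hub≡h
      leaf≡l : leaf w ≡ l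
      leaf≡l = toℕ-injective (trans (toℕ-leaf Mw) (trans (cong (λ x → rank (pendantsAt x) w) anchor≡x) rank≡l))

    label↔ : Fin n ↔ CoronaV (suc s) p m′
    label↔ = mk↔ₛ′ label (λ c → proj₁ (label-surjective c)) (λ c → proj₂ (label-surjective c))
                   (λ u → label-injective (proj₂ (label-surjective (label u))))

    label-adj : ∀ u w → adj G u w ≡ true ⇔ CoronaAdj (label u) (label w)
    label-adj u w with P u in Pu | P w in Pw
    ... | true  | true  = adj⇔ Pu Pw
    ... | true  | false =
      mk⇔ (λ uw → cong hub (anchor-unique (cong not Pw) uw Pu))
          (λ eq → subst (λ x → adj G x w ≡ true) (sym (hub-injective Pu (anchor-P (cong not Pw)) eq))
                        (anchor-adj (cong not Pw)))
    ... | false | true  =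
      mk⇔ (λ uw → cong hub (sym (anchor-unique (cong not Pu) (trans (Graph.sym G w u) uw) Pw)))
          (λ eq → trans (Graph.sym G u w)
                        (subst (λ x → adj G x u ≡ true) (hub-injective (anchor-P (cong not Pu)) Pw eq)
                               (anchor-adj (cong not Pu))))
    ... | false | false =
      mk⇔ (λ uw → contradiction (trans (sym uw) (M-independent (cong not Pu) (cong not Pw))) λ ()) ⊥-elim

    isoToCorona : IsoToCorona G (suc s) p m′
    isoToCorona = label↔ , label-adj

  isHub : ∀ {r p m} → CoronaV r p m → Bool
  isHub (_ , nothing) = true
  isHub (_ , just _)  = false

  module CoronaSignedFunction {n} (G : Graph n) {s p : ℕ} (φ : Fin n ↔ CoronaV (suc s) p (s * p + 1))
    (φ-adj : ∀ u v → adj G u v ≡ true ⇔ CoronaAdj (Inverse.to φ u) (Inverse.to φ v)) where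

    open Degrees G
    open Inverse φ using (to; from; strictlyInverseˡ)

    m : ℕ
    m = s * p + 1

    f : Fin n → ℤ
    f u = if isHub (to u) then 1ℤ else - 1ℤ

    ±1 : ∀ v → f v ≡ 1ℤ ⊎ f v ≡ - 1ℤ
    ±1 v with isHub (to v)
    ... | true  = inj₁ refl
    ... | false = inj₂ refl

    open SignedFunction G f ±1 public

    hubOf : Fin n → Fin (suc s) × Fin p
    hubOf u = proj₁ (to u)

    -- The value on hubs is arbitrary: leafIndex is only used on leaves.
    leafIndex : CoronaV (suc s) p m → Fin m
    leafIndex (_ , just l)  = l
    leafIndex (_ , nothing) = fromℕ< (subst (0 <_) (+-comm 1 (s * p)) z<s)

    hub-shape : ∀ {u} → P u ≡ true → to u ≡ (hubOf u , nothing)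
    hub-shape {u} Pu with to u
    ... | _ , nothing = refl

    leaf-shape : ∀ {u} → M u ≡ true → to u ≡ (hubOf u , just (leafIndex (to u)))
    leaf-shape {u} Mu with to u
    ... | _ , just _ = refl

    P-from : ∀ c → P (from c) ≡ isHub c
    P-from c rewrite strictlyInverseˡ c with isHub c
    ... | true  = refl
    ... | false = refl

    adjacent : ∀ {u v} → adj G u v ≡ true → CoronaAdj (to u) (to v)
    adjacent {u} {v} = Equivalence.to (φ-adj u v)

    attached : ∀ {u v} → M u ≡ true → P v ≡ true → adj G u v ≡ true → hubOf u ≡ hubOf v
    attached Mu Pv uv = subst₂ CoronaAdj (leaf-shape Mu) (hub-shape Pv) (adjacent uv)

    deg-M-hub≤ : ∀ {v} → P v ≡ true → deg M v ≤ m
    deg-M-hub≤ {v} Pv = count-injection-≤ (λ u → leafIndex (to u)) injective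
      where
      pendant-shape : ∀ {u} → (adj G u v ∧ M u) ≡ true → to u ≡ (hubOf v , just (leafIndex (to u)))
      pendant-shape {u} pendant =
        trans (leaf-shape Mu) (cong (_, just (leafIndex (to u))) (attached Mu Pv (∧-conicalˡ _ _ pendant)))
        where
        Mu : M u ≡ true
        Mu = ∧-conicalʳ _ _ pendant
      injective : ∀ {u w} → (adj G u v ∧ M u) ≡ true → (adj G w v ∧ M w) ≡ true →
                  leafIndex (to u) ≡ leafIndex (to w) → u ≡ w
      injective pu pw eq = ↔-injective φ
        (trans (pendant-shape pu) (trans (cong (λ l → hubOf v , just l) eq) (sym (pendant-shape pw))))

    deg-P-hub≥ : ∀ {v} → P v ≡ true → s * p ≤ deg P v
    deg-P-hub≥ {v} Pv = count-injection-≥ neighbour neighbour-adjacent-hub neighbour-injective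
      where
      code : Fin (s * p) ↔ (Fin s × Fin p)
      code = *↔×
      position : Fin (s * p) → CoronaV (suc s) p m
      position k = (punchIn (proj₁ (hubOf v)) (proj₁ (Inverse.to code k)) , proj₂ (Inverse.to code k)) , nothing
      neighbour : Fin (s * p) → Fin n
      neighbour k = from (position k)
      neighbour-adjacent-hub : ∀ k → (adj G (neighbour k) v ∧ P (neighbour k)) ≡ true
      neighbour-adjacent-hub k = cong₂ _∧_
        (Equivalence.from (φ-adj (neighbour k) v)
          (subst₂ CoronaAdj (sym (strictlyInverseˡ (position k))) (sym (hub-shape Pv)) (punchInᵢ≢i _ _)))
        (P-from (position k))
      neighbour-injective : ∀ {k l} → neighbour k ≡ neighbour l → k ≡ l
      neighbour-injective {k} {l} eq = ↔-injective code (cong₂ _,_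
        (punchIn-injective (proj₁ (hubOf v)) _ _ (,-injectiveˡ (,-injectiveˡ same-position)))
        (,-injectiveʳ (,-injectiveˡ same-position)))
        where
        same-position : position k ≡ position l
        same-position = ↔-injective (↔-sym φ) eq

    deg-M-leaf : ∀ {v} → M v ≡ true → deg M v ≡ 0
    deg-M-leaf {v} Mv = absent⇒count≡0 λ u → not-pendant u (M u) refl
      where
      not-pendant : ∀ u b → M u ≡ b → (adj G u v ∧ b) ≡ false
      not-pendant u false _  = ∧-zeroʳ _
      not-pendant u true  Mu with adj G u v in uv
      ... | false = refl
      ... | true  = ⊥-elim (subst₂ CoronaAdj (leaf-shape Mu) (leaf-shape Mv) (adjacent uv))

    deg-P-leaf : ∀ {v} → M v ≡ true → 0 < deg P v
    deg-P-leaf {v} Mv =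
      member⇒count>0 (λ u → adj G u v ∧ P u) {from own-hub} (cong₂ _∧_ hub-adjacent (P-from own-hub))
      where
      own-hub : CoronaV (suc s) p m
      own-hub = hubOf v , nothing
      hub-adjacent : adj G (from own-hub) v ≡ true
      hub-adjacent = Equivalence.from (φ-adj (from own-hub) v)
                       (subst₂ CoronaAdj (sym (strictlyInverseˡ own-hub)) (sym (leaf-shape Mv)) refl)

    local : ∀ v → 𝟙 (M v) + deg M v ≤ 𝟙 (P v) + deg P v
    local v with P v in Pv
    ... | true  = ≤-trans (deg-M-hub≤ Pv) (subst (_≤ suc (deg P v)) (+-comm 1 (s * p)) (s≤s (deg-P-hub≥ Pv)))
    ... | false = subst (λ d → suc d ≤ deg P v) (sym (deg-M-leaf (cong not Pv))) (deg-P-leaf (cong not Pv))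

    nnsdf : IsNNSDF G f
    nnsdf = ±1 , λ v → Equivalence.from (nonnegative⇔ v) (local v)

    hub-code : Fin (suc s * p) ↔ (Fin (suc s) × Fin p)
    hub-code = *↔×

    count-P≤ : count P ≤ suc s * p
    count-P≤ = count-injection-≤ (λ u → Inverse.from hub-code (hubOf u)) injective
      where
      injective : ∀ {u w} → P u ≡ true → P w ≡ true →
                  Inverse.from hub-code (hubOf u) ≡ Inverse.from hub-code (hubOf w) → u ≡ w
      injective Pu Pw eq = ↔-injective φ (trans (hub-shape Pu)
        (trans (cong (_, nothing) (↔-injective (↔-sym hub-code) eq)) (sym (hub-shape Pw))))

    count-M≥ : suc s * p * m ≤ count M
    count-M≥ = count-injection-≥ leaf (λ i → cong not (P-from (position i))) injective
      where
      leaf-code : Fin (suc s * p * m) ↔ (Fin (suc s * p) × Fin m)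
      leaf-code = *↔×
      position : Fin (suc s * p * m) → CoronaV (suc s) p m
      position i = Inverse.to hub-code (proj₁ (Inverse.to leaf-code i)) , just (proj₂ (Inverse.to leaf-code i))
      leaf : Fin (suc s * p * m) → Fin n
      leaf i = from (position i)
      injective : ∀ {i j} → leaf i ≡ leaf j → i ≡ j
      injective {i} {j} eq = ↔-injective leaf-code
        (cong₂ _,_ (↔-injective hub-code (,-injectiveˡ same)) (just-injective (,-injectiveʳ same)))
        where
        same : position i ≡ position j
        same = ↔-injective (↔-sym φ) eq

-- With r = s + 1, D n is the D of the statement and aOf k is its a = (r-1)(γ + n) + 2r when
-- γ = k - m and n = k + m, k and m being the numbers of vertices with value 1 and -1.
module Discriminant (s : ℕ) where

  open import Data.Integer as ℤ using (+_)
  import Data.Integer.Properties as ℤ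
  import Data.Integer.Tactic.RingSolver as ℤ-Ring
  open import Data.Nat
  open import Data.Nat.Properties
  open import Data.Nat.Tactic.RingSolver using (solve-∀)
  open import Relation.Binary.PropositionalEquality

  r : ℕ
  r = suc s

  aOf : ℕ → ℕ
  aOf k = s * (k + k) + 2 * r

  rm-bound : ℕ → ℕ
  rm-bound k = r * k + s * (k * k)

  D : ℕ → ℕ
  D n = r * r + r * s * n

  a≡aOf : ∀ k m → + s ℤ.* ((+ k ℤ.- + m) ℤ.+ + (k + m)) ℤ.+ + (2 * r) ≡ + aOf k
  a≡aOf k m = begin
    + s ℤ.* ((+ k ℤ.- + m) ℤ.+ + (k + m)) ℤ.+ + (2 * r)
      ≡⟨ cong (λ z → + s ℤ.* ((+ k ℤ.- + m) ℤ.+ z) ℤ.+ + (2 * r)) (ℤ.pos-+ k m) ⟩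
    + s ℤ.* ((+ k ℤ.- + m) ℤ.+ (+ k ℤ.+ + m)) ℤ.+ + (2 * r)
      ≡⟨ cancel (+ s) (+ k) (+ m) (+ (2 * r)) ⟩
    + s ℤ.* (+ k ℤ.+ + k) ℤ.+ + (2 * r)
      ≡⟨ cong (λ z → + s ℤ.* z ℤ.+ + (2 * r)) (ℤ.pos-+ k k) ⟨
    + s ℤ.* + (k + k) ℤ.+ + (2 * r)
      ≡⟨ cong (ℤ._+ + (2 * r)) (ℤ.pos-* s (k + k)) ⟨
    + (s * (k + k)) ℤ.+ + (2 * r)
      ≡⟨ ℤ.pos-+ (s * (k + k)) (2 * r) ⟨
    + aOf k ∎
    where
    open ≡-Reasoning
    cancel : ∀ S K M T → S ℤ.* ((K ℤ.- M) ℤ.+ (K ℤ.+ M)) ℤ.+ T ≡ S ℤ.* (K ℤ.+ K) ℤ.+ T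
    cancel = ℤ-Ring.solve-∀

  -- a² - 4D = 4(r-1)(rm-bound k - r m), written with both sides moved so that no subtraction occurs.
  discriminant-identity : ∀ k m → aOf k * aOf k + 4 * s * (r * m) ≡ 4 * D (k + m) + 4 * s * rm-bound k
  discriminant-identity = expanded s
    where
    expanded : ∀ s k m → (s * (k + k) + 2 * suc s) * (s * (k + k) + 2 * suc s) + 4 * s * (suc s * m) ≡
                         4 * (suc s * suc s + suc s * s * (k + m)) + 4 * s * (suc s * k + s * (k * k))
    expanded = solve-∀

  rm-bound-mono : ∀ {k k′} → k ≤ k′ → rm-bound k ≤ rm-bound k′
  rm-bound-mono k≤k′ = +-mono-≤ (*-monoʳ-≤ r k≤k′) (*-monoʳ-≤ s (*-mono-≤ k≤k′ k≤k′))

  rm-bound-corona : ∀ p → rm-bound (r * p) ≡ r * (r * p * (s * p + 1))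
  rm-bound-corona p = expanded s p
    where
    expanded : ∀ s p → suc s * (suc s * p) + s * (suc s * p * (suc s * p)) ≡ suc s * (suc s * p * (s * p + 1))
    expanded = solve-∀

  module _ .{{_ : NonZero s}} {n k m : ℕ} (k+m≡n : k + m ≡ n) where
    private
      instance
        4s-nonZero : NonZero (4 * s)
        4s-nonZero = m*n≢0 4 s

      identity : aOf k * aOf k + 4 * s * (r * m) ≡ 4 * D n + 4 * s * rm-bound k
      identity = subst (λ n → aOf k * aOf k + 4 * s * (r * m) ≡ 4 * D n + 4 * s * rm-bound k)
                       k+m≡n (discriminant-identity k m)

    rm≤⇒4D≤a² : r * m ≤ rm-bound k → 4 * D n ≤ aOf k * aOf k
    rm≤⇒4D≤a² rm≤ = +-cancelʳ-≤ (4 * s * (r * m)) _ _ (begin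
      4 * D n + 4 * s * (r * m)          ≤⟨ +-monoʳ-≤ (4 * D n) (*-monoʳ-≤ (4 * s) rm≤) ⟩
      4 * D n + 4 * s * rm-bound k       ≡⟨ identity ⟨
      aOf k * aOf k + 4 * s * (r * m)    ∎)
      where
      open ≤-Reasoning

    rm≥⇒a²≤4D : rm-bound k ≤ r * m → aOf k * aOf k ≤ 4 * D n
    rm≥⇒a²≤4D ≤rm = +-cancelʳ-≤ (4 * s * (r * m)) _ _ (begin
      aOf k * aOf k + 4 * s * (r * m)    ≡⟨ identity ⟩
      4 * D n + 4 * s * rm-bound k       ≤⟨ +-monoʳ-≤ (4 * D n) (*-monoʳ-≤ (4 * s) ≤rm) ⟩
      4 * D n + 4 * s * (r * m)          ∎)
      where
      open ≤-Reasoning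

    a²≡4D⇒rm≡ : aOf k * aOf k ≡ 4 * D n → r * m ≡ rm-bound k
    a²≡4D⇒rm≡ a²≡4D = *-cancelˡ-≡ _ _ (4 * s)
      (+-cancelˡ-≡ (4 * D n) _ _ (trans (cong (_+ 4 * s * (r * m)) (sym a²≡4D)) identity))

module Extremal {n} (s : ℕ) .{{_ : NonZero s}} (G : Graph n) (free : CliqueFree (suc s) G)
                (γ : ℤ) (dom : IsNNSignedDomNumber G γ) where

  open import Data.Fin using (Fin)
  open import Data.Integer as ℤ using (+_; -_; 0ℤ; 1ℤ; +≤+)
  import Data.Integer.Properties as ℤ
  open import Data.Nat
  open import Data.Nat.Properties
  open import Data.Product using (Σ; ∃; _×_; _,_; proj₁; proj₂)
  open import Data.Sum using (_⊎_)
  open import Defs using (sumFin; IsNNSDF; IsoToCorona)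
  open import Relation.Binary.PropositionalEquality
  open import Relation.Nullary using (contradiction)
  open Counting
  open Turán
  open SignedDomination
  open Corona
  open Discriminant s

  a-signed : ∀ {g} (±1 : ∀ v → g v ≡ 1ℤ ⊎ g v ≡ - 1ℤ) → let open SignedFunction G g ±1 in
             + s ℤ.* (sumFin g ℤ.+ + n) ℤ.+ + (2 * r) ≡ + aOf (count P)
  a-signed {g} ±1 = begin
    + s ℤ.* (sumFin g ℤ.+ + n) ℤ.+ + (2 * r)
      ≡⟨ cong₂ (λ γ n → + s ℤ.* (γ ℤ.+ + n) ℤ.+ + (2 * r)) sumFin≡ (sym (count-complement P)) ⟩
    + s ℤ.* ((+ count P ℤ.- + count M) ℤ.+ + (count P + count M)) ℤ.+ + (2 * r)
      ≡⟨ a≡aOf (count P) (count M) ⟩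
    + aOf (count P) ∎
    where
    open ≡-Reasoning
    open SignedFunction G g ±1

  f : Fin n → ℤ
  f = proj₁ (proj₁ dom)

  nnsdf : IsNNSDF G f
  nnsdf = proj₁ (proj₂ (proj₁ dom))

  open NonnegativeSignedDomination G f nnsdf

  k m : ℕ
  k = count P
  m = count M

  k+m≡n : k + m ≡ n
  k+m≡n = count-complement P

  a : ℤ
  a = + s ℤ.* (γ ℤ.+ + n) ℤ.+ + (2 * r)

  a≡ : a ≡ + aOf k
  a≡ = trans (cong (λ γ → + s ℤ.* (γ ℤ.+ + n) ℤ.+ + (2 * r)) (sym (proj₂ (proj₂ (proj₁ dom)))))
             (a-signed (proj₁ nnsdf))

  0≤a : 0ℤ ℤ.≤ a
  0≤a = subst (0ℤ ℤ.≤_) (sym a≡) (+≤+ z≤n)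

  a²≡ : a ℤ.* a ≡ + (aOf k * aOf k)
  a²≡ = trans (cong₂ ℤ._*_ a≡ a≡) (sym (ℤ.pos-* (aOf k) (aOf k)))

  4D≡ : + 4 ℤ.* + D n ≡ + (4 * D n)
  4D≡ = sym (ℤ.pos-* 4 (D n))

  4D≤a²ₙ : 4 * D n ≤ aOf k * aOf k
  4D≤a²ₙ = rm≤⇒4D≤a² k+m≡n (bound s free)

  4D≤a² : + 4 ℤ.* + D n ℤ.≤ a ℤ.* a
  4D≤a² = subst₂ ℤ._≤_ (sym 4D≡) (sym a²≡) (+≤+ 4D≤a²ₙ)

  a²≡4D⇒corona : n ≥ 1 → a ℤ.* a ≡ + 4 ℤ.* + D n → Σ ℕ λ p → p ≥ 1 × IsoToCorona G r p (s * p + 1)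
  a²≡4D⇒corona n≥1 a²≡4D = corona P-multipartite
    where
    rm≡ : r * m ≡ rm-bound k
    rm≡ = a²≡4D⇒rm≡ k+m≡n (ℤ.+-injective (trans (sym a²≡) (trans a²≡4D 4D≡)))

    open Tight s free rm≡

    corona : (∃ λ p → BalancedCompleteMultipartite G r p P) → Σ ℕ λ p → p ≥ 1 × IsoToCorona G r p (s * p + 1)
    corona (suc p′ , K) = suc p′ , s≤s z≤n , CoronaFromStructure.isoToCorona G P K M-independent M-pendant P-deg
    corona (zero , K) = contradiction (subst (1 ≤_) (trans (sym k+m≡n) (cong₂ _+_ k≡0 m≡0)) n≥1) n≮0
      where
      k≡0 : k ≡ 0
      k≡0 = trans (BalancedCompleteMultipartite.size K) (*-zeroʳ r)
      rm-bound-0 : rm-bound 0 ≡ r * 0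
      rm-bound-0 = trans (cong₂ _+_ (*-zeroʳ r) (*-zeroʳ s)) (sym (*-zeroʳ r))
      m≡0 : m ≡ 0
      m≡0 = *-cancelˡ-≡ m 0 r (trans rm≡ (trans (cong rm-bound k≡0) rm-bound-0))

  corona⇒a²≡4D : (Σ ℕ λ p → p ≥ 1 × IsoToCorona G r p (s * p + 1)) → a ℤ.* a ≡ + 4 ℤ.* + D n
  corona⇒a²≡4D (p , _ , φ , φ-adj) =
    trans a²≡ (trans (cong +_ (≤-antisym (≤-trans (*-mono-≤ a≤a₁ a≤a₁) corona-bound) 4D≤a²ₙ)) (sym 4D≡))
    where
    module C = CoronaSignedFunction G φ φ-adj

    a≤a₁ : aOf k ≤ aOf (count C.P)
    a≤a₁ = ℤ.drop‿+≤+ (subst₂ ℤ._≤_ a≡ (a-signed C.±1)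
             (ℤ.+-monoˡ-≤ (+ (2 * r)) (ℤ.*-monoˡ-≤-nonNeg (+ s) (ℤ.+-monoˡ-≤ (+ n) (proj₂ dom C.f C.nnsdf)))))

    corona-bound : aOf (count C.P) * aOf (count C.P) ≤ 4 * D n
    corona-bound = rm≥⇒a²≤4D (count-complement C.P) (begin
      rm-bound (count C.P)          ≤⟨ rm-bound-mono C.count-P≤ ⟩
      rm-bound (r * p)              ≡⟨ rm-bound-corona p ⟩
      r * (r * p * (s * p + 1))     ≤⟨ *-monoʳ-≤ r C.count-M≥ ⟩
      r * count C.M                 ∎)
      where
      open ≤-Reasoning

open import Defs
open import Data.Nat using (ℕ; suc; _≥_; s≤s; z≤n)
open import Data.Integer using (ℤ; +_; _+_; _*_; _≤_; 0ℤ)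
open import Data.Product using (Σ; _×_; _,_)
open import Function.Bundles using (_⇔_; mk⇔)
open import Relation.Binary.PropositionalEquality using (_≡_)

theorem3p2 : (r : ℕ) → r ≥ 2 → (n : ℕ) → n ≥ 1 → (G : Graph n) →
    CliqueFree r G → (γ : ℤ) → IsNNSignedDomNumber G γ →
    let a = + (r Data.Nat.∸ 1) * (γ + + n) + + (2 Data.Nat.* r)
        D = + (r Data.Nat.* r Data.Nat.+ r Data.Nat.* (r Data.Nat.∸ 1) Data.Nat.* n)
    in (0ℤ ≤ a × + 4 * D ≤ a * a) ×
       ((0ℤ ≤ a × a * a ≡ + 4 * D) ⇔
        Σ ℕ (λ p → p ≥ 1 × IsoToCorona G r p ((r Data.Nat.∸ 1) Data.Nat.* p Data.Nat.+ 1)))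
theorem3p2 (suc (suc s′)) (s≤s (s≤s z≤n)) n n≥1 G free γ dom =
  (0≤a , 4D≤a²) , mk⇔ (λ { (_ , a²≡4D) → a²≡4D⇒corona n≥1 a²≡4D }) (λ corona → 0≤a , corona⇒a²≡4D corona)
  where
  open Extremal (suc s′) G free γ dom
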